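{- Let $p$ be an odd prime, $r\ge1$, and let $g(x)=x^{p^i+p^k}$ and $h(x)=x^{p^s+p^t}$ in $\mathbb{F}_{p^{2r}}[x]$, where $0\le i\le k<2r$ and $0\le s\le t<2r$. Let $f(x)=g(x)+(g(x))^{p^r}+h(x)-(h(x))^{p^r}$. If $f$ is planar on $\mathbb{F}_{p^{2r}}$, then either $r$ is odd and $t-s$ is even, or $r$ is even and $k-i$ is even.
   Context: A function $f$ on $\mathbb{F}_q$ is planar if $x\mapsto f(x+a)-f(x)$ is a bijection for every $a\in\mathbb{F}_q^*$. -}

module Defs where

open import Level using (Level; _⊔_)
open import Data.Nat using (ℕ; _^_)
open import Data.Fin using (Fin)
open import Data.Product using (Σ; ∃; _×_)
open import Relation.Nullary using (¬_)
open import Algebra.Bundles using (CommutativeRing; Semiring)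
open import Relation.Binary.PropositionalEquality using (_≡_)
import Algebra.Definitions.RawSemiring as RS

module _ {c ℓ : Level} (R : CommutativeRing c ℓ) where
  open CommutativeRing R

  pow : Carrier → ℕ → Carrier
  pow = RS._^_ (Semiring.rawSemiring semiring)

  IsFieldR : Set (c ⊔ ℓ)
  IsFieldR = (¬ (1# ≈ 0#)) × (∀ x → ¬ (x ≈ 0#) → ∃ λ y → (x * y) ≈ 1#)

  HasCard : ℕ → Set (c ⊔ ℓ)
  HasCard N = Σ (Fin N → Carrier) λ e →
                (∀ i j → e i ≈ e j → i ≡ j) × (∀ x → ∃ λ i → e i ≈ x)

  IsBijectiveR : (Carrier → Carrier) → Set (c ⊔ ℓ)
  IsBijectiveR F = (∀ x y → F x ≈ F y → x ≈ y) × (∀ z → ∃ λ x → F x ≈ z)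

  IsPlanar : (Carrier → Carrier) → Set (c ⊔ ℓ)
  IsPlanar F = ∀ a → ¬ (a ≈ 0#) → IsBijectiveR (λ x → F (x + a) - F x)

  theF : (p r i k s t : ℕ) → Carrier → Carrier
  theF p r i k s t x =
    ((g + pow g (p ^ r)) + h) - pow h (p ^ r)
    where
      g = pow x (p ^ i Data.Nat.+ p ^ k)
      h = pow x (p ^ s Data.Nat.+ p ^ t)

module Submission where

-- Idea.  f is a sum of Dembowski–Ostrom monomials x^(p^a + p^b), so its derivative
-- in direction 1 splits as  f(x + 1) - f(x) = L(x) + (f(1) - f(0))  with L additive
-- (a sum of Frobenius iterates x^(p^j)).  Planarity makes x ↦ f(x + 1) - f(x)
-- injective, hence L has trivial kernel.  A field of order p^(2r) contains w ≠ 0 with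
-- w^p = -w; then w^(p^j) = (-1)^j w, and if the parities fail the terms of L(w) cancel
-- in pairs, so L(w) = 0, a contradiction.

open import Defs
open import Level using (Level; _⊔_)
open import Algebra.Bundles using (CommutativeRing; CommutativeMonoid)
open import Data.Nat as ℕ using (ℕ; zero; suc)
import Data.Nat.Properties as ℕ
open import Data.Nat.Divisibility using (_∣_; divides; _∣?_)
open import Data.Nat.Primality using (Prime)
open import Data.Nat.Combinatorics using (_C_; nCn≡1)
open import Data.Fin as Fin using (Fin)
import Data.Fin.Properties as Fin
open import Data.Fin.Permutation using (Permutation; permutation)
open import Data.List using (List; []; _∷_; length; foldr; tabulate)
import Data.List.Properties as List
open import Data.List.Relation.Unary.Any using (here; there)
open import Data.List.Relation.Unary.AllPairs using (_∷_)
open import Data.Product using (∃; _×_; _,_; proj₁; proj₂)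
open import Data.Sum using (_⊎_; inj₁; inj₂)
open import Data.Empty using (⊥-elim)
open import Relation.Nullary using (¬_; Dec; yes; no)
open import Relation.Binary.PropositionalEquality as ≡ using (_≡_)
import Algebra.Solver.CommutativeMonoid as CMSolver

module Arithmetic where
  open import Data.Nat
  open import Data.Nat.Properties
  open import Data.Nat.Primality using (prime⇒nonTrivial; euclidsLemma)
  open import Data.Nat.Divisibility using (∣1⇒≡1; ∣⇒≤)
  open import Data.Nat.DivMod using (_/_; m/n*n≡m)
  open import Data.Nat.Combinatorics using (k![n∸k]!∣n!; nCk≡n!/k![n-k]!)
  open import Relation.Binary.PropositionalEquality
  open import Data.Nat.Tactic.RingSolver using (solve-∀)

  prime-form : ∀ {p} → Prime p → ∃ λ m → p ≡ suc (suc m)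
  prime-form {suc (suc m)} _ = m , refl
  prime-form {0} pp with () ← prime⇒nonTrivial pp
  prime-form {1} pp with () ← prime⇒nonTrivial pp

  prime∤factorial : ∀ {p} → Prime p → ∀ m → m < p → ¬ (p ∣ m !)
  prime∤factorial pp zero _ p∣1 with _ , refl ← prime-form pp with () ← ∣1⇒≡1 p∣1
  prime∤factorial pp (suc m) m<p p∣m! with euclidsLemma (suc m) (m !) pp p∣m!
  ... | inj₁ p∣1+m = <⇒≱ m<p (∣⇒≤ p∣1+m)
  ... | inj₂ p∣m!  = prime∤factorial pp m (<-trans (n<1+n m) m<p) p∣m!

  factorial-split : ∀ n k → k ≤ n → n ! ≡ (n C k) * (k ! * (n ∸ k) !)
  factorial-split n k k≤n = begin
    n !                            ≡⟨ m/n*n≡m (k![n∸k]!∣n! k≤n) ⟨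
    (n ! / (k ! * (n ∸ k) !)) * D  ≡⟨ cong (_* D) (nCk≡n!/k![n-k]! k≤n) ⟨
    (n C k) * D                    ∎
    where
    open ≡-Reasoning
    D : ℕ
    D = k ! * (n ∸ k) !
    instance _ = k !* (n ∸ k) !≢0

  prime∣binomial : ∀ {p} → Prime p → ∀ k → 0 < k → k < p → p ∣ p C k
  prime∣binomial {p} pp k 0<k k<p
    with euclidsLemma (p C k) (k ! * (p ∸ k) !) pp
           (subst (p ∣_) (factorial-split p k (<⇒≤ k<p)) p∣p!)
    where
    p∣p! : p ∣ p !
    p∣p! with m , refl ← prime-form pp = divides (suc m !) (*-comm (suc (suc m)) (suc m !))
  ... | inj₁ p∣C = p∣C
  ... | inj₂ p∣k!m! with euclidsLemma (k !) ((p ∸ k) !) pp p∣k!m!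
  ...   | inj₁ p∣k! = ⊥-elim (prime∤factorial pp k k<p p∣k!)
  ...   | inj₂ p∣m! = ⊥-elim (prime∤factorial pp (p ∸ k) (∸-monoʳ-< 0<k (<⇒≤ k<p)) p∣m!)

  even-or-odd : ∀ n → (∃ λ m → n ≡ 2 * m) ⊎ (∃ λ m → n ≡ suc (2 * m))
  even-or-odd zero = inj₁ (0 , refl)
  even-or-odd (suc n) with even-or-odd n
  ... | inj₁ (m , n≡2m)  = inj₂ (m , cong suc n≡2m)
  ... | inj₂ (m , n≡2m+1) = inj₁ (suc m , trans (cong suc n≡2m+1) (sym (*-suc 2 m)))

  odd-form : ∀ {n} → ¬ (2 ∣ n) → ∃ λ m → n ≡ suc (2 * m)
  odd-form {n} 2∤n with even-or-odd n
  ... | inj₁ (m , n≡2m) = ⊥-elim (2∤n (divides m (trans n≡2m (*-comm 2 m))))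
  ... | inj₂ odd        = odd

  -- Even powers of an odd number p = 1 + 2v are ≡ 1 modulo 4v = 2(p - 1).
  odd-even-power : ∀ v r → ∃ λ M → suc (2 * v) ^ (2 * r) ≡ suc (2 * (M * (2 * v)))
  odd-even-power v zero = 0 , refl
  odd-even-power v (suc r) with odd-even-power v r
  ... | M , eq = suc v + M * (p * p) , (begin
    p ^ (2 * suc r)                   ≡⟨ cong (p ^_) (*-suc 2 r) ⟩
    p * (p * p ^ (2 * r))             ≡⟨ cong (λ x → p * (p * x)) eq ⟩
    p * (p * suc (2 * (M * (2 * v)))) ≡⟨ square-step v M ⟩
    suc (2 * ((suc v + M * (p * p)) * (2 * v))) ∎)
    where
    open ≡-Reasoning
    p : ℕ
    p = suc (2 * v)
    square-step : ∀ v M → suc (2 * v) * (suc (2 * v) * suc (2 * (M * (2 * v))))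
                   ≡ suc (2 * ((suc v + M * (suc (2 * v) * suc (2 * v))) * (2 * v)))
    square-step = solve-∀

  -- Hence for q = p^(2r) the exponent (q - 1)/2 is a multiple of p - 1.
  half-order-multiple : ∀ v r k → suc (2 * k) ≡ suc (2 * v) ^ (2 * r) → ∃ λ M → k ≡ M * (2 * v)
  half-order-multiple v r k eq with odd-even-power v r
  ... | M , eq′ = M , *-cancelˡ-≡ k (M * (2 * v)) 2 (suc-injective (trans eq eq′))

open Arithmetic

module ListProduct {c ℓ : Level} (M : CommutativeMonoid c ℓ) where
  open CommutativeMonoid M
  open import Data.List.Membership.Setoid setoid using (_∈_)
  open import Data.List.Membership.Setoid.Properties using (∈-resp-≈; All[≉]⇒∉; ∉⇒All[≉])
  open import Data.List.Relation.Unary.Unique.Setoid setoid using (Unique)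
  open import Algebra.Properties.CommutativeSemigroup commutativeSemigroup using (x∙yz≈y∙xz)

  prod : List Carrier → Carrier
  prod = foldr _∙_ ε

  record Removal (y : Carrier) (xs : List Carrier) : Set (c ⊔ ℓ) where
    field
      rest    : List Carrier
      unique  : Unique rest
      product : prod xs ≈ y ∙ prod rest
      size    : length xs ≡ suc (length rest)
      keeps   : ∀ {u} → u ∈ xs → ¬ (u ≈ y) → u ∈ rest
      within  : ∀ {u} → u ∈ rest → u ∈ xs
      drops   : ∀ {u} → u ∈ rest → ¬ (u ≈ y)

  remove : ∀ {y xs} → Unique xs → y ∈ xs → Removal y xs
  remove {y} {x ∷ xs} (x∉xs ∷ uniq) (here y≈x) = record
    { rest    = xs
    ; unique  = uniq
    ; product = ∙-congʳ (sym y≈x)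
    ; size    = ≡.refl
    ; keeps   = λ { (here u≈x) u≉y → ⊥-elim (u≉y (trans u≈x (sym y≈x))) ; (there u∈xs) _ → u∈xs }
    ; within  = there
    ; drops   = λ u∈xs u≈y → All[≉]⇒∉ setoid x∉xs (∈-resp-≈ setoid (trans u≈y y≈x) u∈xs)
    }
  remove {y} {x ∷ xs} (x∉xs ∷ uniq) (there y∈xs) = record
    { rest    = x ∷ rest
    ; unique  = ∉⇒All[≉] setoid (λ x∈rest → All[≉]⇒∉ setoid x∉xs (within x∈rest)) ∷ unique
    ; product = trans (∙-congˡ product) (x∙yz≈y∙xz x y (prod rest))
    ; size    = ≡.cong suc size
    ; keeps   = λ { (here u≈x) _ → here u≈x ; (there u∈xs) u≉y → there (keeps u∈xs u≉y) }
    ; within  = λ { (here u≈x) → here u≈x ; (there u∈rest) → there (within u∈rest) }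
    ; drops   = λ { (here u≈x) u≈y → All[≉]⇒∉ setoid x∉xs (∈-resp-≈ setoid (trans (sym u≈y) u≈x) y∈xs)
                  ; (there u∈rest) → drops u∈rest }
    }
    where open Removal (remove uniq y∈xs)

module RingTools {c ℓ : Level} (R : CommutativeRing c ℓ) where
  open CommutativeRing R
  open import Algebra.Properties.Ring ring
  open import Relation.Binary.Reasoning.Setoid setoid
  open import Algebra.Properties.CommutativeSemiring.Exp commutativeSemiring
  open import Algebra.Properties.Semiring.Mult semiring using (×-assoc-*; ×-congʳ) renaming (_×_ to _·_)

  -- signed n x = (-1)ⁿ · x, computed as n-fold negation.
  signed : ℕ → Carrier → Carrier
  signed zero    x = x
  signed (suc n) x = - signed n x

  signed-cong : ∀ n {x y} → x ≈ y → signed n x ≈ signed n y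
  signed-cong zero    x≈y = x≈y
  signed-cong (suc n) x≈y = -‿cong (signed-cong n x≈y)

  signed-+ : ∀ m n x → signed (m ℕ.+ n) x ≡ signed m (signed n x)
  signed-+ zero    n x = ≡.refl
  signed-+ (suc m) n x = ≡.cong -_ (signed-+ m n x)

  signed-double : ∀ m x → signed (2 ℕ.* m) x ≈ x
  signed-double zero    x = refl
  signed-double (suc m) x = begin
    signed (2 ℕ.* suc m) x   ≡⟨ ≡.cong (λ n → signed n x) (ℕ.*-suc 2 m) ⟩
    - - signed (2 ℕ.* m) x   ≈⟨ -‿involutive _ ⟩
    signed (2 ℕ.* m) x       ≈⟨ signed-double m x ⟩
    x                        ∎

  signed-even : ∀ {n} → 2 ∣ n → ∀ x → signed n x ≈ x
  signed-even (divides m ≡.refl) x =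
    trans (reflexive (≡.cong (λ n → signed n x) (ℕ.*-comm m 2))) (signed-double m x)

  signed-odd : ∀ {n} → ¬ (2 ∣ n) → ∀ x → signed n x ≈ - x
  signed-odd 2∤n x with m , ≡.refl ← odd-form 2∤n = -‿cong (signed-double m x)

  signed-+-distrib : ∀ n x y → signed n (x + y) ≈ signed n x + signed n y
  signed-+-distrib zero    x y = refl
  signed-+-distrib (suc n) x y = trans (-‿cong (signed-+-distrib n x y)) (sym (-‿+-comm _ _))

  signed-odd-gap : ∀ {m n} → m ℕ.≤ n → ¬ (2 ∣ (n ℕ.∸ m)) → ∀ x → signed n x ≈ - signed m x
  signed-odd-gap {m} {n} m≤n odd x = begin
    signed n x                       ≡⟨ ≡.cong (λ k → signed k x) (ℕ.m∸n+n≡m m≤n) ⟨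
    signed ((n ℕ.∸ m) ℕ.+ m) x       ≡⟨ signed-+ (n ℕ.∸ m) m x ⟩
    signed (n ℕ.∸ m) (signed m x)    ≈⟨ signed-odd odd (signed m x) ⟩
    - signed m x                     ∎

  1^n≈1 : ∀ n → 1# ^ n ≈ 1#
  1^n≈1 zero    = refl
  1^n≈1 (suc n) = trans (*-identityˡ _) (1^n≈1 n)

  module Additive (f : Carrier → Carrier) (f-cong : ∀ {x y} → x ≈ y → f x ≈ f y)
                  (f-+ : ∀ x y → f (x + y) ≈ f x + f y) where
    additive-0 : f 0# ≈ 0#
    additive-0 = +-identityʳ-unique (f 0#) (f 0#) (trans (sym (f-+ 0# 0#)) (f-cong (+-identityʳ 0#)))

    additive-neg : ∀ x → f (- x) ≈ - f x
    additive-neg x = +-inverseˡ-unique (f (- x)) (f x)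
      (trans (sym (f-+ (- x) x)) (trans (f-cong (-‿inverseˡ x)) additive-0))

  module Frobenius {p : ℕ} (p-prime : Prime p) (char : p · 1# ≈ 0#) where
    open import Algebra.Properties.CommutativeSemiring.Binomial commutativeSemiring
      using (binomialTerm; theorem)
    open import Algebra.Properties.Semiring.Mult semiring using (×-homo-1; ×1-homo-*)
    open import Algebra.Properties.Monoid.Sum +-monoid using (sum; sum-init-last; sum-cong-≋; sum-replicate-zero)

    multiple-vanishes : ∀ {n} → p ∣ n → ∀ z → n · z ≈ 0#
    multiple-vanishes (divides q ≡.refl) z = begin
      (q ℕ.* p) · z                ≈⟨ ×-congʳ (q ℕ.* p) (*-identityˡ z) ⟨
      (q ℕ.* p) · (1# * z)         ≈⟨ ×-assoc-* (q ℕ.* p) 1# z ⟨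
      ((q ℕ.* p) · 1#) * z         ≈⟨ *-congʳ (×1-homo-* q p) ⟩
      ((q · 1#) * (p · 1#)) * z    ≈⟨ *-congʳ (*-congˡ char) ⟩
      ((q · 1#) * 0#) * z          ≈⟨ *-congʳ (zeroʳ _) ⟩
      0# * z                       ≈⟨ zeroˡ z ⟩
      0#                           ∎

    -- Binomial theorem: the end terms give x^p and y^p, the inner coefficients C(p,k) vanish.
    frobenius-+ : ∀ x y → (x + y) ^ p ≈ x ^ p + y ^ p
    frobenius-+ x y with m , ≡.refl ← prime-form p-prime = begin
      (x + y) ^ p                                           ≈⟨ theorem p x y ⟩
      T Fin.zero + sum (λ i → T (Fin.suc i))                ≈⟨ +-congˡ (sum-init-last (λ i → T (Fin.suc i))) ⟩
      T Fin.zero + (sum inner + T (Fin.suc (Fin.fromℕ (suc m))))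
        ≈⟨ +-cong first-term (+-cong inner-vanishes last-term) ⟩
      y ^ p + (0# + x ^ p)                                  ≈⟨ +-congˡ (+-identityˡ _) ⟩
      y ^ p + x ^ p                                         ≈⟨ +-comm _ _ ⟩
      x ^ p + y ^ p                                         ∎
      where
      T : Fin (suc p) → Carrier
      T = binomialTerm x y p
      inner : Fin (suc m) → Carrier
      inner i = T (Fin.suc (Fin.inject₁ i))

      first-term : T Fin.zero ≈ y ^ p
      first-term = trans (×-homo-1 _) (*-identityˡ _)

      last-term : T (Fin.suc (Fin.fromℕ (suc m))) ≈ x ^ p
      last-term = begin
        (p C k) · (x ^ k * y ^ (p ℕ.∸ k))  ≡⟨ ≡.cong (λ j → (p C j) · (x ^ j * y ^ (p ℕ.∸ j))) k≡p ⟩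
        (p C p) · (x ^ p * y ^ (p ℕ.∸ p))  ≡⟨ ≡.cong₂ (λ a b → a · (x ^ p * y ^ b)) (nCn≡1 p) (ℕ.n∸n≡0 p) ⟩
        1 · (x ^ p * 1#)                   ≈⟨ trans (×-homo-1 _) (*-identityʳ _) ⟩
        x ^ p                              ∎
        where
        k : ℕ
        k = Fin.toℕ (Fin.suc (Fin.fromℕ (suc m)))
        k≡p : k ≡ p
        k≡p = ≡.cong suc (Fin.toℕ-fromℕ (suc m))

      inner-vanishes : sum inner ≈ 0#
      inner-vanishes = trans (sum-cong-≋ vanish) (sum-replicate-zero (suc m))
        where
        vanish : ∀ i → inner i ≈ 0#
        vanish i = multiple-vanishes
          (prime∣binomial p-prime (suc (Fin.toℕ (Fin.inject₁ i))) (ℕ.s≤s ℕ.z≤n)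
            (ℕ.s≤s (≡.subst (ℕ._< suc m) (≡.sym (Fin.toℕ-inject₁ i)) (Fin.toℕ<n i))))
          _

    frob : ℕ → Carrier → Carrier
    frob j x = x ^ (p ℕ.^ j)

    frob-cong : ∀ j {x y} → x ≈ y → frob j x ≈ frob j y
    frob-cong j = ^-congˡ (p ℕ.^ j)

    frob-suc : ∀ j x → frob (suc j) x ≈ frob j (x ^ p)
    frob-suc j x = sym (^-assocʳ x p (p ℕ.^ j))

    frob-+ : ∀ j x y → frob j (x + y) ≈ frob j x + frob j y
    frob-+ zero    x y = trans (*-identityʳ _) (sym (+-cong (*-identityʳ x) (*-identityʳ y)))
    frob-+ (suc j) x y = begin
      frob (suc j) (x + y)             ≈⟨ frob-suc j (x + y) ⟩
      frob j ((x + y) ^ p)             ≈⟨ frob-cong j (frobenius-+ x y) ⟩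
      frob j (x ^ p + y ^ p)           ≈⟨ frob-+ j (x ^ p) (y ^ p) ⟩
      frob j (x ^ p) + frob j (y ^ p)  ≈⟨ +-cong (frob-suc j x) (frob-suc j y) ⟨
      frob (suc j) x + frob (suc j) y  ∎

    frob-* : ∀ j x y → frob j (x * y) ≈ frob j x * frob j y
    frob-* j x y = ^-distrib-* x y (p ℕ.^ j)

    frob-1 : ∀ j → frob j 1# ≈ 1#
    frob-1 j = 1^n≈1 (p ℕ.^ j)

    frob-0 : ∀ j → frob j 0# ≈ 0#
    frob-0 j = Additive.additive-0 (frob j) (frob-cong j) (frob-+ j)

    frob-neg : ∀ j x → frob j (- x) ≈ - frob j x
    frob-neg j = Additive.additive-neg (frob j) (frob-cong j) (frob-+ j)

    frob-shift : ∀ j x → frob j (x + 1#) ≈ frob j x + 1#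
    frob-shift j x = trans (frob-+ j x 1#) (+-congˡ (frob-1 j))

    frob-anti : ∀ {w} → w ^ p ≈ - w → ∀ j → frob j w ≈ signed j w
    frob-anti {w} w^p≈-w zero    = *-identityʳ w
    frob-anti {w} w^p≈-w (suc j) = begin
      frob (suc j) w      ≈⟨ frob-suc j w ⟩
      frob j (w ^ p)      ≈⟨ frob-cong j w^p≈-w ⟩
      frob j (- w)        ≈⟨ frob-neg j w ⟩
      - frob j w          ≈⟨ -‿cong (frob-anti w^p≈-w j) ⟩
      - signed j w        ∎

    frob-frob : ∀ a b x → frob b (frob a x) ≈ frob (a ℕ.+ b) x
    frob-frob a b x = begin
      (x ^ (p ℕ.^ a)) ^ (p ℕ.^ b)  ≈⟨ ^-assocʳ x (p ℕ.^ a) (p ℕ.^ b) ⟩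
      x ^ (p ℕ.^ a ℕ.* p ℕ.^ b)    ≡⟨ ≡.cong (x ^_) (ℕ.^-distribˡ-+-* p a b) ⟨
      x ^ (p ℕ.^ (a ℕ.+ b))        ∎

    monomial linear : ℕ → ℕ → Carrier → Carrier
    monomial a b x = frob a x * frob b x
    linear   a b x = frob a x + frob b x

    monomial-shift : ∀ a b x → monomial a b (x + 1#) ≈ monomial a b x + (linear a b x + 1#)
    monomial-shift a b x = begin
      frob a (x + 1#) * frob b (x + 1#)  ≈⟨ *-cong (frob-shift a x) (frob-shift b x) ⟩
      (A + 1#) * (B + 1#)                ≈⟨ distribʳ (B + 1#) A 1# ⟩
      A * (B + 1#) + 1# * (B + 1#)       ≈⟨ +-cong (distribˡ A B 1#) (*-identityˡ _) ⟩
      (A * B + A * 1#) + (B + 1#)        ≈⟨ +-congʳ (+-congˡ (*-identityʳ A)) ⟩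
      (A * B + A) + (B + 1#)             ≈⟨ +-assoc _ _ _ ⟩
      A * B + (A + (B + 1#))             ≈⟨ +-congˡ (+-assoc A B 1#) ⟨
      A * B + ((A + B) + 1#)             ∎
      where
      A B : Carrier
      A = frob a x
      B = frob b x

    regroup : ∀ X₁ X₂ X₃ X₄ L₁ L₂ L₃ L₄ →
      (((X₁ + (L₁ + 1#)) + (X₂ + (L₂ + 1#))) + (X₃ + (L₃ + 1#))) - (X₄ + (L₄ + 1#))
        ≈ (((X₁ + X₂) + X₃) - X₄) + ((((L₁ + L₂) + L₃) - L₄) + (((1# + 1#) + 1#) - 1#))
    regroup X₁ X₂ X₃ X₄ L₁ L₂ L₃ L₄ = begin
      (((X₁ + (L₁ + 1#)) + (X₂ + (L₂ + 1#))) + (X₃ + (L₃ + 1#))) - (X₄ + (L₄ + 1#))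
        ≈⟨ +-congˡ (trans (sym (-‿+-comm X₄ _)) (+-congˡ (sym (-‿+-comm L₄ 1#)))) ⟩
      (((X₁ + (L₁ + 1#)) + (X₂ + (L₂ + 1#))) + (X₃ + (L₃ + 1#))) + (- X₄ + (- L₄ + - 1#))
        ≈⟨ solve 10 (λ x₁ x₂ x₃ y₄ l₁ l₂ l₃ m₄ o n →
             (((x₁ ⊕ (l₁ ⊕ o)) ⊕ (x₂ ⊕ (l₂ ⊕ o))) ⊕ (x₃ ⊕ (l₃ ⊕ o))) ⊕ (y₄ ⊕ (m₄ ⊕ n))
             ⊜ (((x₁ ⊕ x₂) ⊕ x₃) ⊕ y₄) ⊕ ((((l₁ ⊕ l₂) ⊕ l₃) ⊕ m₄) ⊕ (((o ⊕ o) ⊕ o) ⊕ n)))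
           refl X₁ X₂ X₃ (- X₄) L₁ L₂ L₃ (- L₄) 1# (- 1#) ⟩
      (((X₁ + X₂) + X₃) - X₄) + ((((L₁ + L₂) + L₃) - L₄) + (((1# + 1#) + 1#) - 1#)) ∎
      where open CMSolver +-commutativeMonoid

    difference : ∀ {x y z} → x ≈ y + z → x - y ≈ z
    difference {x} {y} {z} x≈y+z = begin
      x - y        ≈⟨ +-congʳ (trans x≈y+z (+-comm y z)) ⟩
      (z + y) - y  ≈⟨ +-assoc z y (- y) ⟩
      z + (y - y)  ≈⟨ +-congˡ (-‿inverseʳ y) ⟩
      z + 0#       ≈⟨ +-identityʳ z ⟩
      z            ∎

    module Planar (r i k s t : ℕ) where
      F : Carrier → Carrier
      F = theF R p r i k s t

      F-form : ∀ x → F x ≈ ((monomial i k x + monomial (i ℕ.+ r) (k ℕ.+ r) x) + monomial s t x)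
                           - monomial (s ℕ.+ r) (t ℕ.+ r) x
      F-form x = +-cong (+-cong (+-cong (^-homo-* x (p ℕ.^ i) (p ℕ.^ k)) (twisted i k))
                                        (^-homo-* x (p ℕ.^ s) (p ℕ.^ t)))
                                (-‿cong (twisted s t))
        where
        twisted : ∀ a b → (x ^ (p ℕ.^ a ℕ.+ p ℕ.^ b)) ^ (p ℕ.^ r) ≈ monomial (a ℕ.+ r) (b ℕ.+ r) x
        twisted a b = trans (^-congˡ (p ℕ.^ r) (^-homo-* x (p ℕ.^ a) (p ℕ.^ b)))
                            (trans (frob-* r _ _) (*-cong (frob-frob a r x) (frob-frob b r x)))

      linearPart : Carrier → Carrier
      linearPart x = ((linear i k x + linear (i ℕ.+ r) (k ℕ.+ r) x) + linear s t x)
                     - linear (s ℕ.+ r) (t ℕ.+ r) x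

      derivative : ∀ x → F (x + 1#) - F x ≈ linearPart x + (((1# + 1#) + 1#) - 1#)
      derivative x = difference (begin
        F (x + 1#)
          ≈⟨ F-form (x + 1#) ⟩
        ((monomial i k (x + 1#) + monomial (i ℕ.+ r) (k ℕ.+ r) (x + 1#)) + monomial s t (x + 1#))
          - monomial (s ℕ.+ r) (t ℕ.+ r) (x + 1#)
          ≈⟨ +-cong (+-cong (+-cong (monomial-shift i k x) (monomial-shift (i ℕ.+ r) (k ℕ.+ r) x))
                            (monomial-shift s t x))
                    (-‿cong (monomial-shift (s ℕ.+ r) (t ℕ.+ r) x)) ⟩
        _ ≈⟨ regroup _ _ _ _ _ _ _ _ ⟩
        _ ≈⟨ +-congʳ (sym (F-form x)) ⟩
        F x + (linearPart x + (((1# + 1#) + 1#) - 1#)) ∎)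

      linearPart-0 : linearPart 0# ≈ 0#
      linearPart-0 = begin
        linearPart 0#                    ≈⟨ +-cong (+-cong (+-cong (linear-0 i k) (linear-0 (i ℕ.+ r) (k ℕ.+ r))) (linear-0 s t))
                                                   (-‿cong (linear-0 (s ℕ.+ r) (t ℕ.+ r))) ⟩
        ((0# + 0#) + 0#) - 0#            ≈⟨ +-cong (trans (+-identityʳ _) (+-identityʳ _)) -0#≈0# ⟩
        0# + 0#                          ≈⟨ +-identityʳ 0# ⟩
        0#                               ∎
        where
        linear-0 : ∀ a b → linear a b 0# ≈ 0#
        linear-0 a b = trans (+-cong (frob-0 a) (frob-0 b)) (+-identityʳ 0#)

      planar⇒kernel-trivial : ¬ (1# ≈ 0#) → IsPlanar R F → ∀ x → linearPart x ≈ 0# → x ≈ 0#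
      planar⇒kernel-trivial 1≉0 planar x Lx≈0 = proj₁ (planar 1# 1≉0) x 0# (begin
        F (x + 1#) - F x                             ≈⟨ derivative x ⟩
        linearPart x + (((1# + 1#) + 1#) - 1#)       ≈⟨ +-congʳ (trans Lx≈0 (sym linearPart-0)) ⟩
        linearPart 0# + (((1# + 1#) + 1#) - 1#)      ≈⟨ derivative 0# ⟨
        F (0# + 1#) - F 0#                           ∎)

      module AntiFixed {w : Carrier} (w^p≈-w : w ^ p ≈ - w) where
        linear-gap : ∀ {a b} → a ℕ.≤ b → ¬ (2 ∣ (b ℕ.∸ a)) → linear a b w ≈ 0#
        linear-gap {a} {b} a≤b odd = begin
          frob a w + frob b w        ≈⟨ +-cong (frob-anti w^p≈-w a) (frob-anti w^p≈-w b) ⟩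
          signed a w + signed b w    ≈⟨ +-congˡ (signed-odd-gap a≤b odd w) ⟩
          signed a w - signed a w    ≈⟨ -‿inverseʳ _ ⟩
          0#                         ∎

        linear-twist : ∀ a b → linear (a ℕ.+ r) (b ℕ.+ r) w ≈ signed r (linear a b w)
        linear-twist a b = trans (+-cong (twist a) (twist b)) (sym (signed-+-distrib r _ _))
          where
          twist : ∀ a → frob (a ℕ.+ r) w ≈ signed r (frob a w)
          twist a = begin
            frob (a ℕ.+ r) w        ≈⟨ frob-anti w^p≈-w (a ℕ.+ r) ⟩
            signed (a ℕ.+ r) w      ≡⟨ ≡.cong (λ n → signed n w) (ℕ.+-comm a r) ⟩
            signed (r ℕ.+ a) w      ≡⟨ signed-+ r a w ⟩
            signed r (signed a w)   ≈⟨ signed-cong r (frob-anti w^p≈-w a) ⟨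
            signed r (frob a w)     ∎

        -- r odd, t - s odd: the g-terms cancel each other, the h-terms vanish.
        vanishes-r-odd : ¬ (2 ∣ r) → s ℕ.≤ t → ¬ (2 ∣ (t ℕ.∸ s)) → linearPart w ≈ 0#
        vanishes-r-odd r-odd s≤t gap = begin
          ((L + linear (i ℕ.+ r) (k ℕ.+ r) w) + linear s t w) - linear (s ℕ.+ r) (t ℕ.+ r) w
            ≈⟨ +-cong (+-cong (+-congˡ (trans (linear-twist i k) (signed-odd r-odd L)))
                              (linear-gap s≤t gap))
                      (-‿cong (trans (linear-twist s t) (trans (signed-cong r (linear-gap s≤t gap))
                                                                  (signed-odd r-odd 0#)))) ⟩
          ((L - L) + 0#) - (- 0#)   ≈⟨ +-cong (trans (+-identityʳ _) (-‿inverseʳ L)) (-‿involutive 0#) ⟩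
          0# + 0#                   ≈⟨ +-identityʳ 0# ⟩
          0#                        ∎
          where L = linear i k w

        -- r even, k - i odd: the g-terms vanish, the h-terms cancel each other.
        vanishes-r-even : 2 ∣ r → i ℕ.≤ k → ¬ (2 ∣ (k ℕ.∸ i)) → linearPart w ≈ 0#
        vanishes-r-even r-even i≤k gap = begin
          ((linear i k w + linear (i ℕ.+ r) (k ℕ.+ r) w) + L) - linear (s ℕ.+ r) (t ℕ.+ r) w
            ≈⟨ +-cong (+-congʳ (+-cong (linear-gap i≤k gap)
                                       (trans (linear-twist i k) (trans (signed-even r-even _) (linear-gap i≤k gap)))))
                      (-‿cong (trans (linear-twist s t) (signed-even r-even L))) ⟩
          ((0# + 0#) + L) - L       ≈⟨ +-congʳ (trans (+-congʳ (+-identityʳ 0#)) (+-identityˡ L)) ⟩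
          L - L                     ≈⟨ -‿inverseʳ L ⟩
          0#                        ∎
          where L = linear s t w

      parity-constraint : ¬ (1# ≈ 0#) → IsPlanar R F → ∀ {w} → ¬ (w ≈ 0#) → w ^ p ≈ - w →
        i ℕ.≤ k → s ℕ.≤ t → ((¬ (2 ∣ r)) × (2 ∣ (t ℕ.∸ s))) ⊎ ((2 ∣ r) × (2 ∣ (k ℕ.∸ i)))
      parity-constraint 1≉0 planar w≉0 w^p≈-w i≤k s≤t with 2 ∣? r
      ... | yes r-even with 2 ∣? (k ℕ.∸ i)
      ...   | yes k-i-even = inj₂ (r-even , k-i-even)
      ...   | no  k-i-odd  = ⊥-elim (w≉0 (planar⇒kernel-trivial 1≉0 planar _
                                          (vanishes-r-even r-even i≤k k-i-odd)))
        where open AntiFixed w^p≈-w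
      parity-constraint 1≉0 planar w≉0 w^p≈-w i≤k s≤t | no r-odd with 2 ∣? (t ℕ.∸ s)
      ...   | yes t-s-even = inj₁ (r-odd , t-s-even)
      ...   | no  t-s-odd  = ⊥-elim (w≉0 (planar⇒kernel-trivial 1≉0 planar _
                                          (vanishes-r-odd r-odd s≤t t-s-odd)))
        where open AntiFixed w^p≈-w

injective⇒surjective : ∀ {n} (g : Fin n → Fin n) → (∀ {i j} → g i ≡ g j → i ≡ j) → ∀ t → ∃ λ a → g a ≡ t
injective⇒surjective {n} g g-inj t with Fin.any? (λ a → g a Fin.≟ t)
... | yes hit = hit
... | no miss = ⊥-elim (ℕ.<-irrefl ≡.refl (Fin.injective⇒≤ G-inj))
  where
  -- Without a preimage of t, adjoining t to g gives an injection Fin (suc n) → Fin n.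
  G : Fin (suc n) → Fin n
  G Fin.zero    = t
  G (Fin.suc a) = g a
  G-inj : ∀ {i j} → G i ≡ G j → i ≡ j
  G-inj {Fin.zero}  {Fin.zero}  _   = ≡.refl
  G-inj {Fin.zero}  {Fin.suc j} t≡g = ⊥-elim (miss (j , ≡.sym t≡g))
  G-inj {Fin.suc i} {Fin.zero}  g≡t = ⊥-elim (miss (i , g≡t))
  G-inj {Fin.suc i} {Fin.suc j} g≡g = ≡.cong Fin.suc (g-inj g≡g)

module FieldTools {c ℓ : Level} (R : CommutativeRing c ℓ) (isField : IsFieldR R) where
  open CommutativeRing R
  open import Algebra.Properties.Ring ring
  open import Algebra.Properties.Semiring.Exp semiring using (_^_)
  open import Relation.Binary.Reasoning.Setoid setoid
  open import Data.List.Membership.Setoid setoid using (_∈_)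
  open import Data.List.Relation.Unary.Unique.Setoid setoid using (Unique)
  open ListProduct *-commutativeMonoid public

  1≉0 : ¬ (1# ≈ 0#)
  1≉0 = proj₁ isField

  inverse : ∀ {z} → ¬ (z ≈ 0#) → ∃ λ z′ → z * z′ ≈ 1#
  inverse = proj₂ isField _

  *-cancelʳ : ∀ {z} → ¬ (z ≈ 0#) → ∀ {x y} → x * z ≈ y * z → x ≈ y
  *-cancelʳ {z} z≉0 {x} {y} xz≈yz with z′ , zz′≈1 ← inverse z≉0 = begin
    x               ≈⟨ *-identityʳ x ⟨
    x * 1#          ≈⟨ *-congˡ zz′≈1 ⟨
    x * (z * z′)    ≈⟨ *-assoc x _ z′ ⟨
    (x * z) * z′    ≈⟨ *-congʳ xz≈yz ⟩
    (y * z) * z′    ≈⟨ *-assoc y _ z′ ⟩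
    y * (z * z′)    ≈⟨ *-congˡ zz′≈1 ⟩
    y * 1#          ≈⟨ *-identityʳ y ⟩
    y               ∎

  nonzero-* : ∀ {x y} → ¬ (x ≈ 0#) → ¬ (y ≈ 0#) → ¬ (x * y ≈ 0#)
  nonzero-* x≉0 y≉0 xy≈0 = x≉0 (*-cancelʳ y≉0 (trans xy≈0 (sym (zeroˡ _))))

  nonzero-^ : ∀ {x} → ¬ (x ≈ 0#) → ∀ n → ¬ (x ^ n ≈ 0#)
  nonzero-^ x≉0 zero    = 1≉0
  nonzero-^ x≉0 (suc n) = nonzero-* x≉0 (nonzero-^ x≉0 n)

  factor-nonzero : ∀ {x y z} → ¬ (z ≈ 0#) → x * y ≈ z → ¬ (y ≈ 0#)
  factor-nonzero z≉0 xy≈z y≈0 = z≉0 (trans (sym xy≈z) (trans (*-congˡ y≈0) (zeroʳ _)))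

  same-cofactor : ∀ {a x y z} → ¬ (a ≈ 0#) → x * z ≈ a → y * z ≈ a → x ≈ y
  same-cofactor a≉0 xz≈a yz≈a = *-cancelʳ (factor-nonzero a≉0 xz≈a) (trans xz≈a (sym yz≈a))

  square-one : ∀ {x} → x * x ≈ 1# → ¬ (x ≈ 1#) → x ≈ - 1#
  square-one {x} x²≈1 x≉1 = +-inverseˡ-unique x 1# (*-cancelʳ x-1≉0 (begin
    (x + 1#) * (x - 1#)            ≈⟨ *-comm _ _ ⟩
    (x - 1#) * (x + 1#)            ≈⟨ [y-z]x≈yx-zx (x + 1#) x 1# ⟩
    x * (x + 1#) - 1# * (x + 1#)   ≈⟨ +-cong (distribˡ x x 1#) (-‿cong (*-identityˡ _)) ⟩
    (x * x + x * 1#) - (x + 1#)    ≈⟨ +-congʳ (+-cong x²≈1 (*-identityʳ x)) ⟩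
    (1# + x) - (x + 1#)            ≈⟨ +-congʳ (+-comm 1# x) ⟩
    (x + 1#) - (x + 1#)            ≈⟨ -‿inverseʳ _ ⟩
    0#                             ≈⟨ zeroˡ _ ⟨
    0# * (x - 1#)                  ∎))
    where
    x-1≉0 : ¬ (x - 1# ≈ 0#)
    x-1≉0 x-1≈0 = x≉1 (x∙y⁻¹≈ε⇒x≈y x 1# x-1≈0)

  Paired : Carrier → List Carrier → Set (c ⊔ ℓ)
  Paired c xs = ∀ {x} → x ∈ xs → ∃ λ y → y ∈ xs × x * y ≈ c × ¬ (y ≈ x)

  pairing : ∀ {c} → ¬ (c ≈ 0#) → ∀ {xs} → Unique xs → Paired c xs →
            ∃ λ m → prod xs ≈ c ^ m × 2 ℕ.* m ≡ length xs
  pairing {c} c≉0 {xs} uniq paired = bounded (length xs) ℕ.≤-refl uniq paired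
    where
    bounded : ∀ n {xs} → length xs ℕ.≤ n → Unique xs → Paired c xs →
              ∃ λ m → prod xs ≈ c ^ m × 2 ℕ.* m ≡ length xs
    bounded n       {[]}     _   _    _      = 0 , refl , ≡.refl
    bounded (suc n) {x ∷ xs} len uniq paired
      with y , y∈xs , xy≈c , y≉x ← paired (here refl) =
      suc m , product-eq , size-eq
      where
      module R₁ = Removal (remove uniq (here refl))
      module R₂ = Removal (remove R₁.unique (R₁.keeps y∈xs y≉x))

      paired-rest : Paired c R₂.rest
      paired-rest u∈ with v , v∈ , uv≈c , v≉u ← paired (R₁.within (R₂.within u∈)) =
        v , R₂.keeps (R₁.keeps v∈ v≉x) v≉y , uv≈c , v≉u
        where
        v≉x : ¬ (v ≈ x)
        v≉x v≈x = R₂.drops u∈ (same-cofactor c≉0 (trans (*-congˡ (sym v≈x)) uv≈c)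
                                                  (trans (*-comm y x) xy≈c))
        v≉y : ¬ (v ≈ y)
        v≉y v≈y = R₁.drops (R₂.within u∈) (same-cofactor c≉0 (trans (*-congˡ (sym v≈y)) uv≈c) xy≈c)

      len-rest : length R₂.rest ℕ.≤ n
      len-rest = ℕ.≤-trans (ℕ.n≤1+n _)
        (ℕ.≤-pred (≡.subst (ℕ._≤ suc n) (≡.trans R₁.size (≡.cong suc R₂.size)) len))

      induction : ∃ λ m → prod R₂.rest ≈ c ^ m × 2 ℕ.* m ≡ length R₂.rest
      induction = bounded n len-rest R₂.unique paired-rest
      m : ℕ
      m = proj₁ induction

      product-eq : prod (x ∷ xs) ≈ c * c ^ m
      product-eq = begin
        prod (x ∷ xs)               ≈⟨ R₁.product ⟩
        x * prod R₁.rest            ≈⟨ *-congˡ R₂.product ⟩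
        x * (y * prod R₂.rest)      ≈⟨ *-assoc x y _ ⟨
        (x * y) * prod R₂.rest      ≈⟨ *-cong xy≈c (proj₁ (proj₂ induction)) ⟩
        c * c ^ m                   ∎

      size-eq : 2 ℕ.* suc m ≡ length (x ∷ xs)
      size-eq = ≡.trans (ℕ.*-suc 2 m)
        (≡.trans (≡.cong (λ l → suc (suc l)) (proj₂ (proj₂ induction)))
                 (≡.sym (≡.trans R₁.size (≡.cong suc R₂.size))))

module FiniteField {c ℓ : Level} (R : CommutativeRing c ℓ) (isField : IsFieldR R)
                   {N : ℕ} (card : HasCard R N) where
  open CommutativeRing R
  open import Algebra.Properties.Ring ring
  open import Algebra.Properties.Semiring.Exp semiring using (_^_; ^-assocʳ)
  open import Algebra.Properties.Semiring.Mult semiring using (×1-homo-*) renaming (_×_ to _·_)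
  open import Algebra.Properties.CommutativeMonoid.Sum +-commutativeMonoid
    using (sum; sum-permute; sum-cong-≋; ∑-distrib-+; sum-replicate)
  open import Relation.Binary.Reasoning.Setoid setoid
  open import Data.List.Membership.Setoid setoid using (_∈_)
  open import Data.List.Membership.Setoid.Properties using (∈-resp-≈; ∈-tabulate⁺)
  open import Data.List.Relation.Unary.Unique.Setoid.Properties using (tabulate⁺)
  open FieldTools R isField
  open RingTools R using (1^n≈1)

  enum : Fin N → Carrier
  enum = proj₁ card

  enum-injective : ∀ {i j} → enum i ≈ enum j → i ≡ j
  enum-injective = proj₁ (proj₂ card) _ _

  index : Carrier → Fin N
  index x = proj₁ (proj₂ (proj₂ card) x)

  enum-index : ∀ x → enum (index x) ≈ x
  enum-index x = proj₂ (proj₂ (proj₂ card) x)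

  index-cong : ∀ {x y} → x ≈ y → index x ≡ index y
  index-cong x≈y = enum-injective (trans (enum-index _) (trans x≈y (sym (enum-index _))))

  infix 4 _≟_
  _≟_ : (x y : Carrier) → Dec (x ≈ y)
  x ≟ y with index x Fin.≟ index y
  ... | yes eq = yes (trans (sym (enum-index x)) (trans (reflexive (≡.cong enum eq)) (enum-index y)))
  ... | no ne  = no (λ x≈y → ne (index-cong x≈y))

  translate : Carrier → Fin N → Fin N
  translate a i = index (enum i + a)

  translate-cancel : ∀ {a b} → b + a ≈ 0# → ∀ i → translate a (translate b i) ≡ i
  translate-cancel {a} {b} b+a≈0 i = enum-injective (begin
    enum (translate a (translate b i))  ≈⟨ enum-index _ ⟩
    enum (translate b i) + a            ≈⟨ +-congʳ (enum-index _) ⟩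
    (enum i + b) + a                    ≈⟨ +-assoc _ b a ⟩
    enum i + (b + a)                    ≈⟨ +-congˡ b+a≈0 ⟩
    enum i + 0#                         ≈⟨ +-identityʳ _ ⟩
    enum i                              ∎)

  translation : Permutation N N
  translation = permutation (translate 1#) (translate (- 1#))
    (translate-cancel (-‿inverseˡ 1#)) (translate-cancel (-‿inverseʳ 1#))

  -- Translation by 1 permutes the elements, so Σ x = Σ (x + 1) = Σ x + N · 1.
  card-annihilates : N · 1# ≈ 0#
  card-annihilates = +-identityʳ-unique (sum enum) (N · 1#) (sym (begin
    sum enum                              ≈⟨ sum-permute enum translation ⟩
    sum (λ i → enum (translate 1# i))     ≈⟨ sum-cong-≋ {N} (λ i → enum-index (enum i + 1#)) ⟩
    sum (λ i → enum i + 1#)               ≈⟨ ∑-distrib-+ {N} enum (λ _ → 1#) ⟩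
    sum enum + sum {N} (λ _ → 1#)         ≈⟨ +-congˡ (sum-replicate N) ⟩
    sum enum + N · 1#                     ∎))

  zero-power : ∀ {x} n → x ^ n ≈ 0# → x ≈ 0#
  zero-power {x} n xⁿ≈0 with x ≟ 0#
  ... | yes x≈0 = x≈0
  ... | no  x≉0 = ⊥-elim (nonzero-^ x≉0 n xⁿ≈0)

  ·1-^ : ∀ p n → (p ℕ.^ n) · 1# ≈ (p · 1#) ^ n
  ·1-^ p zero    = +-identityʳ 1#
  ·1-^ p (suc n) = trans (×1-homo-* p (p ℕ.^ n)) (*-congˡ (·1-^ p n))

  characteristic : ∀ {p n} → N ≡ p ℕ.^ n → p · 1# ≈ 0#
  characteristic {p} {n} N≡pⁿ = zero-power n (begin
    (p · 1#) ^ n    ≈⟨ ·1-^ p n ⟨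
    (p ℕ.^ n) · 1#  ≡⟨ ≡.cong (_· 1#) N≡pⁿ ⟨
    N · 1#          ≈⟨ card-annihilates ⟩
    0#              ∎)

  elements : List Carrier
  elements = tabulate enum

  elements-complete : ∀ x → x ∈ elements
  elements-complete x = ∈-resp-≈ setoid (enum-index x) (∈-tabulate⁺ setoid (index x))

  module Units = Removal (remove (tabulate⁺ setoid enum-injective) (elements-complete 0#))

  units : List Carrier
  units = Units.rest

  unit-intro : ∀ {x} → ¬ (x ≈ 0#) → x ∈ units
  unit-intro x≉0 = Units.keeps (elements-complete _) x≉0

  units-size : suc (length units) ≡ N
  units-size = ≡.trans (≡.sym Units.size) (List.length-tabulate enum)

  -1*-1≈1 : - 1# * - 1# ≈ 1#
  -1*-1≈1 = trans (-1*x≈-x (- 1#)) (-‿involutive 1#)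

  -- Wilson's theorem: pairing each unit other than ±1 with its inverse.
  wilson : ¬ (1# ≈ - 1#) → prod units ≈ - 1#
  wilson 1≉-1 = begin
    prod units                       ≈⟨ R₁.product ⟩
    1# * prod R₁.rest                ≈⟨ *-identityˡ _ ⟩
    prod R₁.rest                     ≈⟨ R₂.product ⟩
    - 1# * prod R₂.rest              ≈⟨ *-congˡ rest≈1 ⟩
    - 1# * 1#                        ≈⟨ *-identityʳ _ ⟩
    - 1#                             ∎
    where
    -1≉0 : ¬ (- 1# ≈ 0#)
    -1≉0 -1≈0 = 1≉0 (trans (sym (-‿involutive 1#)) (trans (-‿cong -1≈0) -0#≈0#))

    module R₁ = Removal (remove Units.unique (unit-intro 1≉0))
    module R₂ = Removal (remove R₁.unique (R₁.keeps (unit-intro -1≉0) (λ -1≈1 → 1≉-1 (sym -1≈1))))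

    inverse-paired : Paired 1# R₂.rest
    inverse-paired {x} x∈ with y , xy≈1 ← inverse (Units.drops (R₁.within (R₂.within x∈))) =
      y , R₂.keeps (R₁.keeps (unit-intro y≉0) y≉1) y≉-1 , xy≈1 , y≉x
      where
      x≉1 : ¬ (x ≈ 1#)
      x≉1 = R₁.drops (R₂.within x∈)
      x≉-1 : ¬ (x ≈ - 1#)
      x≉-1 = R₂.drops x∈
      y≉0 : ¬ (y ≈ 0#)
      y≉0 = factor-nonzero 1≉0 xy≈1
      y≉1 : ¬ (y ≈ 1#)
      y≉1 y≈1 = x≉1 (same-cofactor 1≉0 (trans (*-congˡ (sym y≈1)) xy≈1) (*-identityˡ 1#))
      y≉-1 : ¬ (y ≈ - 1#)
      y≉-1 y≈-1 = x≉-1 (same-cofactor 1≉0 (trans (*-congˡ (sym y≈-1)) xy≈1) -1*-1≈1)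
      y≉x : ¬ (y ≈ x)
      y≉x y≈x = x≉-1 (square-one (trans (*-congˡ (sym y≈x)) xy≈1) x≉1)

    rest≈1 : prod R₂.rest ≈ 1#
    rest≈1 with m , prod≈1^m , _ ← pairing 1≉0 R₂.unique inverse-paired = trans prod≈1^m (1^n≈1 m)

  IsSquare : Carrier → Set (c ⊔ ℓ)
  IsSquare x = ∃ λ y → y * y ≈ x

  square-resp : ∀ {x y} → x ≈ y → IsSquare x → IsSquare y
  square-resp x≈y (z , z²≈x) = z , trans z²≈x x≈y

  square? : ∀ x → Dec (IsSquare x)
  square? x with Fin.any? (λ j → enum j * enum j ≟ x)
  ... | yes (j , sq) = yes (enum j , sq)
  ... | no  none     = no λ (y , y²≈x) → none (index y , trans (*-cong (enum-index y) (enum-index y)) y²≈x)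

  -- If 1 ≠ -1 then not every element is a square: a choice of square roots would be
  -- injective, hence onto, but 1 and -1 would have to be roots of the same element 1.
  not-all-squares : ¬ (1# ≈ - 1#) → ¬ (∀ x → IsSquare x)
  not-all-squares 1≉-1 all-squares = 1≉-1 (begin
    1#                   ≈⟨ enum-index 1# ⟨
    enum (index 1#)      ≡⟨ ≡.cong enum same-index ⟩
    enum (index (- 1#))  ≈⟨ enum-index (- 1#) ⟩
    - 1#                 ∎)
    where
    root-index : Fin N → Fin N
    root-index i = index (proj₁ (all-squares (enum i)))

    square-of-root : ∀ i → enum (root-index i) * enum (root-index i) ≈ enum i
    square-of-root i = trans (*-cong (enum-index _) (enum-index _)) (proj₂ (all-squares (enum i)))

    root-injective : ∀ {i j} → root-index i ≡ root-index j → i ≡ j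
    root-injective {i} {j} eq = enum-injective
      (trans (sym (square-of-root i)) (trans (reflexive (≡.cong (λ k → enum k * enum k) eq)) (square-of-root j)))

    preimage : ∀ t → ∃ λ a → root-index a ≡ t
    preimage = injective⇒surjective root-index root-injective

    preimage-is-1 : ∀ {x} → x * x ≈ 1# → enum (proj₁ (preimage (index x))) ≈ 1#
    preimage-is-1 {x} x²≈1 with a , root-a≡x ← preimage (index x) = begin
      enum a                                     ≈⟨ square-of-root a ⟨
      enum (root-index a) * enum (root-index a)  ≡⟨ ≡.cong (λ k → enum k * enum k) root-a≡x ⟩
      enum (index x) * enum (index x)            ≈⟨ *-cong (enum-index x) (enum-index x) ⟩
      x * x                                      ≈⟨ x²≈1 ⟩
      1#                                         ∎

    same-index : index 1# ≡ index (- 1#)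
    same-index = ≡.trans (≡.sym (proj₂ (preimage (index 1#))))
      (≡.trans (≡.cong root-index (enum-injective (trans (preimage-is-1 (*-identityˡ 1#))
                                                         (sym (preimage-is-1 -1*-1≈1)))))
               (proj₂ (preimage (index (- 1#)))))

  nonsquare : ¬ (1# ≈ - 1#) → ∃ λ c → ¬ IsSquare c
  nonsquare 1≉-1 with i , not-square ← Fin.¬∀⟶∃¬ N (λ i → IsSquare (enum i)) (λ i → square? (enum i))
      (λ all → not-all-squares 1≉-1 (λ x → square-resp (enum-index x) (all (index x)))) =
    enum i , not-square

  nonsquare-nonzero : ∀ {c} → ¬ IsSquare c → ¬ (c ≈ 0#)
  nonsquare-nonzero nonsq c≈0 = nonsq (0# , trans (zeroˡ 0#) (sym c≈0))

  -- Euler's criterion: for a nonsquare c, pairing x with c / x shows c ^ ((N-1)/2) = ∏ units = -1.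
  euler : ¬ (1# ≈ - 1#) → ∀ {c} → ¬ IsSquare c →
          ∃ λ m → c ^ m ≈ - 1# × suc (2 ℕ.* m) ≡ N
  euler 1≉-1 {c} nonsq =
    m , trans (sym (proj₁ (proj₂ pairs))) (wilson 1≉-1) , ≡.trans (≡.cong suc (proj₂ (proj₂ pairs))) units-size
    where
    c≉0 : ¬ (c ≈ 0#)
    c≉0 = nonsquare-nonzero nonsq

    cofactor-paired : Paired c units
    cofactor-paired {x} x∈ with x′ , xx′≈1 ← inverse (Units.drops x∈) =
      c * x′ , unit-intro (factor-nonzero c≉0 x*cx′≈c) , x*cx′≈c ,
      λ cx′≈x → nonsq (x , trans (*-congˡ (sym cx′≈x)) x*cx′≈c)
      where
      x*cx′≈c : x * (c * x′) ≈ c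
      x*cx′≈c = begin
        x * (c * x′)   ≈⟨ x∙yz≈y∙xz x c x′ ⟩
        c * (x * x′)   ≈⟨ *-congˡ xx′≈1 ⟩
        c * 1#         ≈⟨ *-identityʳ c ⟩
        c              ∎
        where open import Algebra.Properties.CommutativeSemigroup *-commutativeSemigroup using (x∙yz≈y∙xz)

    pairs : ∃ λ m → prod units ≈ c ^ m × 2 ℕ.* m ≡ length units
    pairs = pairing c≉0 Units.unique cofactor-paired
    m : ℕ
    m = proj₁ pairs

  odd-characteristic : ∀ v → suc (2 ℕ.* v) · 1# ≈ 0# → ¬ (1# ≈ - 1#)
  odd-characteristic v char 1≈-1 = 1≉0 (begin
    1#                      ≈⟨ +-identityʳ 1# ⟨
    1# + 0#                 ≈⟨ +-congˡ even-vanishes ⟨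
    1# + (2 ℕ.* v) · 1#     ≈⟨ char ⟩
    0#                      ∎)
    where
    even-vanishes : (2 ℕ.* v) · 1# ≈ 0#
    even-vanishes = begin
      (2 ℕ.* v) · 1#             ≈⟨ ×1-homo-* 2 v ⟩
      (1# + (1# + 0#)) * (v · 1#) ≈⟨ *-congʳ (+-congˡ (+-identityʳ 1#)) ⟩
      (1# + 1#) * (v · 1#)        ≈⟨ *-congʳ (trans (+-congˡ 1≈-1) (-‿inverseʳ 1#)) ⟩
      0# * (v · 1#)               ≈⟨ zeroˡ _ ⟩
      0#                          ∎

  -- In a field of order p ^ (2r), p an odd prime, some w ≠ 0 satisfies w ^ p = - w:
  -- w = c ^ ((N - 1) / (2 (p - 1))) for a nonsquare c.
  anti-fixed-element : ∀ {p r} → ¬ (2 ∣ p) → N ≡ p ℕ.^ (2 ℕ.* r) → ∃ λ w → ¬ (w ≈ 0#) × w ^ p ≈ - w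
  anti-fixed-element {p} {r} p-odd N≡ with v , ≡.refl ← odd-form p-odd
    with 1≉-1 ← odd-characteristic v (characteristic {suc (2 ℕ.* v)} {2 ℕ.* r} N≡)
    with c , nonsq ← nonsquare 1≉-1
    with m , cᵐ≈-1 , size ← euler 1≉-1 nonsq
    with M , ≡.refl ← half-order-multiple v r m (≡.trans size N≡) =
    c ^ M , nonzero-^ (nonsquare-nonzero nonsq) M , (begin
      (c ^ M) ^ suc (2 ℕ.* v)              ≡⟨⟩
      c ^ M * (c ^ M) ^ (2 ℕ.* v)          ≈⟨ *-congˡ (^-assocʳ c M (2 ℕ.* v)) ⟩
      c ^ M * c ^ (M ℕ.* (2 ℕ.* v))        ≈⟨ *-congˡ cᵐ≈-1 ⟩
      c ^ M * - 1#                         ≈⟨ *-comm _ _ ⟩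
      - 1# * c ^ M                         ≈⟨ -1*x≈-x _ ⟩
      - c ^ M                              ∎)

open import Data.Nat using (ℕ; _^_; _*_; _∸_; _≤_; _<_)
open import Data.Nat.Divisibility using (_∣_)
open import Data.Nat.Primality using (Prime)
open import Data.Product using (_×_)
open import Data.Sum using (_⊎_)
open import Relation.Nullary using (¬_)
open import Algebra.Bundles using (CommutativeRing)

theorem11 : {c ℓ : Level} (R : CommutativeRing c ℓ) (p r i k s t : ℕ) →
    Prime p → ¬ (2 ∣ p) → 1 ≤ r →
    IsFieldR R → HasCard R (p ^ (2 * r)) →
    i ≤ k → k < 2 * r → s ≤ t → t < 2 * r →
    IsPlanar R (theF R p r i k s t) →
    ((¬ (2 ∣ r)) × (2 ∣ (t ∸ s))) ⊎ ((2 ∣ r) × (2 ∣ (k ∸ i)))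
theorem11 R p r i k s t p-prime p-odd _ isField card i≤k _ s≤t _ planar
  with w , w≉0 , w^p≈-w ← FiniteField.anti-fixed-element R isField card {p} {r} p-odd ≡.refl =
  parity-constraint (FieldTools.1≉0 R isField) planar w≉0 w^p≈-w i≤k s≤t
  where
  open RingTools.Frobenius R p-prime (FiniteField.characteristic R isField card {p} {2 * r} ≡.refl)
  open Planar r i k s t using (parity-constraint)
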